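{- Let $N \equiv 14 \pmod{16}$ and let $(\lambda_1^{m_1}\lambda_2^{m_2})$ be a partition of $N$ into exactly two part sizes. Then for at least one $i \in \{1,2\}$ we have $\ell(\lambda_i) \not\equiv \ell(m_i) \pmod 8$.
   Context: A partition with exactly two part sizes is written $(\lambda_1^{m_1}\lambda_2^{m_2})$ with $\lambda_1>\lambda_2\ge1$ the part sizes and $m_1,m_2\ge1$ their multiplicities. For a positive integer $m$ written uniquely as $m = 2^k t$ with $t$ odd, $\ell(m) = t$ denotes the largest odd divisor of $m$. -}

module Defs where

open import Data.Nat using (ℕ; zero; suc; _+_; _*_)
open import Data.Nat.Base using (_%_; _/_)

-- Largest odd divisor: for m = 2^k * t with t odd, oddPartFuel f m = t
-- whenever f ≥ k (each step removes one factor 2).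
oddPartFuel : ℕ → ℕ → ℕ
oddPartFuel zero    m = m
oddPartFuel (suc f) zero = zero
oddPartFuel (suc f) (suc m) with (suc m) % 2
... | zero  = oddPartFuel f (suc m / 2)
... | suc _ = suc m

-- ℓ(m): the largest odd divisor of a positive integer m (k ≤ m fuel suffices).
-- (ℓ 0 = 0 by convention; never used on 0.)
ℓ : ℕ → ℕ
ℓ m = oddPartFuel m m

-- If ℓ(λ) ≡ ℓ(m) (mod 8) then λ·m = 2^k·w with w = ℓ(λ)·ℓ(m) ≡ ℓ(λ)² ≡ 1 (mod 8),
-- so λ·m is congruent modulo 16 to one of 0, 1, 2, 4, 8, 9. No two of these residues
-- sum to 14 modulo 16, so the two products cannot both be of this form.
module Submission where

open import Defs
open import Data.Nat.Base using (ℕ; zero; suc; _+_; _*_; _/_; _%_; _^_; _≤_; _<_; s≤s; z≤n)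
open import Data.Nat.Properties
  using ( _≟_; allUpTo?; ≤-refl; ≤-trans; ≤-pred; <⇒≤; *-identityˡ; *-assoc
        ; [m*n]*[o*p]≡[m*o]*[n*p]; ^-distribˡ-+-*)
open import Data.Nat.DivMod
  using (m%n<n; %-distribˡ-*; %-distribˡ-+; m∣n⇒o%n%m≡o%m; m*[n/m]≡n; m/n<m; m≥n⇒m/n>0)
open import Data.Nat.Divisibility using (divides-refl; m%n≡0⇒n∣m)
open import Data.List.Base using (List; []; _∷_)
open import Data.List.Membership.Propositional using (_∈_)
open import Data.List.Membership.DecPropositional _≟_ using (_∈?_)
open import Data.List.Relation.Unary.All as All using (All; all?)
open import Data.Product using (∃; _×_; _,_)
open import Data.Sum using (_⊎_; inj₁; inj₂)
open import Function.Base using (_∘_)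
open import Relation.Binary.PropositionalEquality
  using (_≡_; _≢_; refl; sym; trans; cong; cong₂; subst; module ≡-Reasoning)
open import Relation.Nullary using (yes; no; ¬?; contradiction)
open import Relation.Nullary.Decidable using (toWitness; _→-dec_)

oddPartFuel-decomposition : ∀ f m → 1 ≤ m → m ≤ f →
  ∃ λ k → m ≡ 2 ^ k * oddPartFuel f m × oddPartFuel f m % 2 ≡ 1
oddPartFuel-decomposition (suc f) 1 _ _ = 0 , refl , refl
oddPartFuel-decomposition (suc f) (suc (suc m)) _ (s≤s 1+m≤f)
  with suc (suc m) % 2 in parity | m%n<n (suc (suc m)) 2
... | 1 | _ = 0 , sym (*-identityˡ (suc (suc m))) , parity
... | suc (suc _) | s≤s (s≤s ())
... | zero | _ = doubled (oddPartFuel-decomposition f half 1≤half half≤f)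
  where
  open ≡-Reasoning
  half : ℕ
  half = suc (suc m) / 2
  1≤half : 1 ≤ half
  1≤half = m≥n⇒m/n>0 {suc (suc m)} {2} (s≤s (s≤s z≤n))
  half≤f : half ≤ f
  half≤f = ≤-trans (≤-pred (m/n<m (suc (suc m)) 2 (s≤s (s≤s z≤n)))) 1+m≤f
  doubled : (∃ λ k → half ≡ 2 ^ k * oddPartFuel f half × oddPartFuel f half % 2 ≡ 1) →
            ∃ λ k → suc (suc m) ≡ 2 ^ k * oddPartFuel f half × oddPartFuel f half % 2 ≡ 1
  doubled (k , half≡ , odd) = suc k , (begin
    suc (suc m)                      ≡⟨ sym (m*[n/m]≡n (m%n≡0⇒n∣m _ 2 parity)) ⟩
    2 * half                         ≡⟨ cong (2 *_) half≡ ⟩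
    2 * (2 ^ k * oddPartFuel f half) ≡⟨ sym (*-assoc 2 (2 ^ k) _) ⟩
    2 ^ suc k * oddPartFuel f half   ∎) , odd

ℓ-decomposition : ∀ m → 1 ≤ m → ∃ λ k → m ≡ 2 ^ k * ℓ m × ℓ m % 2 ≡ 1
ℓ-decomposition m 1≤m = oddPartFuel-decomposition m m 1≤m ≤-refl

m%2≡1⇒m*m%8≡1 : ∀ m → m % 2 ≡ 1 → m * m % 8 ≡ 1
m%2≡1⇒m*m%8≡1 m m%2≡1 = begin
  m * m % 8             ≡⟨ %-distribˡ-* m m 8 ⟩
  m % 8 * (m % 8) % 8   ≡⟨ oddResidueSquare (m%n<n m 8) m%8%2≡1 ⟩
  1                     ∎
  where
  open ≡-Reasoning
  m%8%2≡1 : m % 8 % 2 ≡ 1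
  m%8%2≡1 = trans (m∣n⇒o%n%m≡o%m 2 8 m (divides-refl 4)) m%2≡1
  oddResidueSquare : ∀ {r} → r < 8 → r % 2 ≡ 1 → r * r % 8 ≡ 1
  oddResidueSquare = toWitness {a? = allUpTo? (λ r → (r % 2 ≟ 1) →-dec (r * r % 8 ≟ 1)) 8} _

m%2≡1∧m≡n[mod8]⇒m*n%8≡1 : ∀ m n → m % 2 ≡ 1 → m % 8 ≡ n % 8 → m * n % 8 ≡ 1
m%2≡1∧m≡n[mod8]⇒m*n%8≡1 m n m%2≡1 m≡n = begin
  m * n % 8             ≡⟨ %-distribˡ-* m n 8 ⟩
  m % 8 * (n % 8) % 8   ≡⟨ cong (λ r → m % 8 * r % 8) (sym m≡n) ⟩
  m % 8 * (m % 8) % 8   ≡⟨ sym (%-distribˡ-* m m 8) ⟩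
  m * m % 8             ≡⟨ m%2≡1⇒m*m%8≡1 m m%2≡1 ⟩
  1                     ∎
  where open ≡-Reasoning

twoPowerResidues : List ℕ
twoPowerResidues = 0 ∷ 1 ∷ 2 ∷ 4 ∷ 8 ∷ 9 ∷ []

2^k*w%16∈twoPowerResidues : ∀ k w → w % 8 ≡ 1 → 2 ^ k * w % 16 ∈ twoPowerResidues
2^k*w%16∈twoPowerResidues zero w w%8≡1 rewrite *-identityˡ w =
  oneMod8Residue (m%n<n w 16) (trans (m∣n⇒o%n%m≡o%m 8 16 w (divides-refl 2)) w%8≡1)
  where
  oneMod8Residue : ∀ {r} → r < 16 → r % 8 ≡ 1 → r ∈ twoPowerResidues
  oneMod8Residue =
    toWitness {a? = allUpTo? (λ r → (r % 8 ≟ 1) →-dec (r ∈? twoPowerResidues)) 16} _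
2^k*w%16∈twoPowerResidues (suc k) w w%8≡1 =
  subst (_∈ twoPowerResidues) (sym doubling)
    (All.lookup closedUnderDoubling (2^k*w%16∈twoPowerResidues k w w%8≡1))
  where
  open ≡-Reasoning
  doubling : 2 ^ suc k * w % 16 ≡ 2 * (2 ^ k * w % 16) % 16
  doubling = begin
    2 ^ suc k * w % 16         ≡⟨ cong (_% 16) (*-assoc 2 (2 ^ k) w) ⟩
    2 * (2 ^ k * w) % 16       ≡⟨ %-distribˡ-* 2 (2 ^ k * w) 16 ⟩
    2 * (2 ^ k * w % 16) % 16  ∎
  closedUnderDoubling : All (λ r → 2 * r % 16 ∈ twoPowerResidues) twoPowerResidues
  closedUnderDoubling =
    toWitness {a? = all? (λ r → 2 * r % 16 ∈? twoPowerResidues) twoPowerResidues} _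

twoPowerResidue-sum≢14 : ∀ a b → a % 16 ∈ twoPowerResidues → b % 16 ∈ twoPowerResidues →
                         (a + b) % 16 ≢ 14
twoPowerResidue-sum≢14 a b a∈ b∈ =
  All.lookup (All.lookup sums≢14 a∈) b∈ ∘ trans (sym (%-distribˡ-+ a b 16))
  where
  sums≢14 : All (λ r → All (λ s → (r + s) % 16 ≢ 14) twoPowerResidues) twoPowerResidues
  sums≢14 = toWitness
    {a? = all? (λ r → all? (λ s → ¬? ((r + s) % 16 ≟ 14)) twoPowerResidues) twoPowerResidues} _

ℓ≡[mod8]⇒*%16∈twoPowerResidues : ∀ x y → 1 ≤ x → 1 ≤ y → ℓ x % 8 ≡ ℓ y % 8 →
                                 x * y % 16 ∈ twoPowerResidues
ℓ≡[mod8]⇒*%16∈twoPowerResidues x y 1≤x 1≤y ℓx≡ℓy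
  with a , x≡ , ℓx-odd ← ℓ-decomposition x 1≤x | b , y≡ , _ ← ℓ-decomposition y 1≤y =
  subst (λ n → n % 16 ∈ twoPowerResidues) (sym x*y≡)
    (2^k*w%16∈twoPowerResidues (a + b) (ℓ x * ℓ y)
      (m%2≡1∧m≡n[mod8]⇒m*n%8≡1 (ℓ x) (ℓ y) ℓx-odd ℓx≡ℓy))
  where
  open ≡-Reasoning
  x*y≡ : x * y ≡ 2 ^ (a + b) * (ℓ x * ℓ y)
  x*y≡ = begin
    x * y                            ≡⟨ cong₂ _*_ x≡ y≡ ⟩
    2 ^ a * ℓ x * (2 ^ b * ℓ y)      ≡⟨ [m*n]*[o*p]≡[m*o]*[n*p] (2 ^ a) (ℓ x) (2 ^ b) (ℓ y) ⟩
    2 ^ a * 2 ^ b * (ℓ x * ℓ y)      ≡⟨ cong (_* (ℓ x * ℓ y)) (sym (^-distribˡ-+-* 2 a b)) ⟩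
    2 ^ (a + b) * (ℓ x * ℓ y)        ∎

lemma3p3 : (N λ₁ λ₂ m₁ m₂ : ℕ) →
    N % 16 ≡ 14 →
    1 ≤ λ₂ → λ₂ < λ₁ → 1 ≤ m₁ → 1 ≤ m₂ →
    λ₁ * m₁ + λ₂ * m₂ ≡ N →
    (ℓ λ₁ % 8 ≢ ℓ m₁ % 8) ⊎ (ℓ λ₂ % 8 ≢ ℓ m₂ % 8)
lemma3p3 N λ₁ λ₂ m₁ m₂ N%16≡14 1≤λ₂ λ₂<λ₁ 1≤m₁ 1≤m₂ partition
  with ℓ λ₁ % 8 ≟ ℓ m₁ % 8 | ℓ λ₂ % 8 ≟ ℓ m₂ % 8
... | no ≢₁  | _      = inj₁ ≢₁
... | yes _  | no ≢₂  = inj₂ ≢₂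
... | yes ≡₁ | yes ≡₂ = contradiction (trans (cong (_% 16) partition) N%16≡14)
  (twoPowerResidue-sum≢14 (λ₁ * m₁) (λ₂ * m₂)
    (ℓ≡[mod8]⇒*%16∈twoPowerResidues λ₁ m₁ (≤-trans 1≤λ₂ (<⇒≤ λ₂<λ₁)) 1≤m₁ ≡₁)
    (ℓ≡[mod8]⇒*%16∈twoPowerResidues λ₂ m₂ 1≤λ₂ 1≤m₂ ≡₂))
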